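{- Let $T$ be a ditree and $H$ a digraph such that $\gamma(T\mathbin{\Box} H)=\gamma(T)\gamma(H)$. If $T'$ is obtained from $T$ by adding a new vertex $x$ and a single arc $xv$ for some vertex $v$ of $T$, such that $\gamma(T')=\gamma(T)+1$, then $\gamma(T'\mathbin{\Box} H)=\gamma(T')\gamma(H)$.
   Context: All digraphs are finite, and their arc relation is irreflexive. A ditree is a digraph whose underlying graph (the undirected graph in which $u,v$ are adjacent iff $uv$ or $vu$ is an arc) is a tree. A set $S$ is dominating if every vertex not in $S$ is an out-neighbor of some vertex of $S$; $\gamma$ is the minimum size of a dominating set. The Cartesian product $G\mathbin{\Box} H$ has vertex set $V(G)\times V(H)$, with an arc from $(g_1,h_1)$ to $(g_2,h_2)$ iff either $g_1=g_2$ and $h_1h_2\in A(H)$, or $h_1=h_2$ and $g_1g_2\in A(G)$. -}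

module Defs where

open import Data.Nat using (ℕ; zero; suc; _*_; _≤_; _≥_)
open import Data.Fin using (Fin; zero; suc; remQuot)
open import Data.Fin.Subset using (Subset; _∈_; ∣_∣)
open import Data.List using (List; []; _∷_; length; last)
open import Data.List.Relation.Unary.Unique.Propositional using (Unique)
open import Data.Maybe using (just)
open import Data.Product using (Σ; ∃; ∃-syntax; _×_; _,_; proj₁; proj₂)
open import Data.Sum using (_⊎_; inj₁; inj₂)
open import Data.Empty using (⊥)
open import Relation.Nullary using (¬_)
open import Relation.Binary.PropositionalEquality using (_≡_)

record Digraph : Set₁ where
  field
    n     : ℕ
    arc   : Fin n → Fin n → Set
    irrefl : ∀ v → ¬ arc v v
open Digraph public

Adj : (G : Digraph) → Fin (n G) → Fin (n G) → Set
Adj G u v = arc G u v ⊎ arc G v u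

data Walk (G : Digraph) : Fin (n G) → Fin (n G) → Set where
  here : ∀ {u} → Walk G u u
  step : ∀ {u w v} → Adj G u w → Walk G w v → Walk G u v

Connected : Digraph → Set
Connected G = ∀ u v → Walk G u v

data Chain (G : Digraph) : List (Fin (n G)) → Set where
  nil  : Chain G []
  one  : ∀ {u} → Chain G (u ∷ [])
  cons : ∀ {u w vs} → Adj G u w → Chain G (w ∷ vs) → Chain G (u ∷ w ∷ vs)

Cycle : (G : Digraph) → List (Fin (n G)) → Set
Cycle G [] = ⊥
Cycle G (v ∷ vs) =
  3 ≤ length (v ∷ vs) × Unique (v ∷ vs) × Chain G (v ∷ vs) ×
  Σ (Fin (n G)) (λ w → (last (v ∷ vs) ≡ just w) × Adj G w v)

IsDitree : Digraph → Set
IsDitree G = (n G ≥ 1) × Connected G × (∀ cs → ¬ Cycle G cs)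

Dominating : (G : Digraph) → Subset (n G) → Set
Dominating G S = ∀ v → (v ∈ S) ⊎ (∃[ u ] (u ∈ S × arc G u v))

IsDomNumber : Digraph → ℕ → Set
IsDomNumber G k =
  (∃[ S ] (Dominating G S × ∣ S ∣ ≡ k)) × (∀ S → Dominating G S → k ≤ ∣ S ∣)

-- Cartesian product G □ H on Fin (n G * n H), vertex combine g h ↔ (g , h).
prodArc : (G H : Digraph) → Fin (n G * n H) → Fin (n G * n H) → Set
prodArc G H p q =
  (proj₁ (remQuot {n G} (n H) p) ≡ proj₁ (remQuot {n G} (n H) q) ×
     arc H (proj₂ (remQuot {n G} (n H) p)) (proj₂ (remQuot {n G} (n H) q)))
  ⊎ (proj₂ (remQuot {n G} (n H) p) ≡ proj₂ (remQuot {n G} (n H) q) ×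
     arc G (proj₁ (remQuot {n G} (n H) p)) (proj₁ (remQuot {n G} (n H) q)))

prodIrrefl : (G H : Digraph) → ∀ p → ¬ prodArc G H p p
prodIrrefl G H p (inj₁ (_ , a)) = irrefl H _ a
prodIrrefl G H p (inj₂ (_ , a)) = irrefl G _ a

_□_ : Digraph → Digraph → Digraph
G □ H = record { n = n G * n H ; arc = prodArc G H ; irrefl = prodIrrefl G H }

-- T' : add a new vertex x (= zero) and a single arc x → v (old vertex i ↦ suc i).
leafArc : (T : Digraph) → Fin (n T) → Fin (suc (n T)) → Fin (suc (n T)) → Set
leafArc T v zero    zero    = ⊥
leafArc T v zero    (suc j) = j ≡ v
leafArc T v (suc i) zero    = ⊥
leafArc T v (suc i) (suc j) = arc T i j

leafIrrefl : (T : Digraph) (v : Fin (n T)) → ∀ u → ¬ leafArc T v u u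
leafIrrefl T v zero ()
leafIrrefl T v (suc i) a = irrefl T i a

addOutLeaf : (T : Digraph) → Fin (n T) → Digraph
addOutLeaf T v = record { n = suc (n T) ; arc = leafArc T v ; irrefl = leafIrrefl T v }

-- Write x for the new vertex. A dominating set of H on the fibre {x} × H together with one of
-- T □ H shows γ(T′ □ H) ≤ γ(H) + γ(T □ H) = γ(T′) γ(H). Conversely, an acyclic digraph has a
-- packing P (vertices with pairwise disjoint closed in-neighbourhoods N⁻[p]) and a dominating
-- set of size at most |P|, both built greedily: a leaf that is not yet dominated is packed and
-- its parent, or the leaf itself, is taken into the dominating set. Hence γ(T′) ≤ |P|. Every
-- dominating set of T′ □ H meets each fibre N⁻[p] × H in a set whose projection dominates H, so
-- it has at least |P| γ(H) ≥ γ(T′) γ(H) vertices.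

module Submission where

open import Defs
open import Data.Nat using (ℕ; zero; suc; _+_; _*_; _≤_; z≤n; s≤s; _≤?_)
open import Data.Nat.Properties
  using (≤-refl; ≤-trans; +-identityʳ; ≤-reflexive; +-comm; +-suc; +-mono-≤; +-monoʳ-≤; *-monoˡ-≤; m≤n+m; n≤1+n; ≰⇒>; <⇒≱; module ≤-Reasoning)
open import Data.Fin using (Fin; zero; suc; _↑ˡ_; _↑ʳ_; join; splitAt; combine; remQuot; quotient; remainder)
  renaming (_<_ to _<ᶠ_)
open import Data.Fin.Properties using (_≟_; any?; pigeonhole; remQuot-combine; splitAt-↑ʳ; join-splitAt)
open import Data.Fin.Subset using (Subset; inside; outside; _∈_; _∉_; _⊂_; ⊤; ⊥; ⁅_⁆; _∪_; _∩_; _─_; _-_; ∣_∣; Nonempty; Empty)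
open import Data.Fin.Subset.Properties
  using (_∈?_; nonempty?; ∈⊤; x∈⁅x⁆; x≢y⇒x∉⁅y⁆; ∣⁅x⁆∣≡1; ∣⊥∣≡0; x∈p∪q⁺; x∈p∪q⁻; x∈p∩q⁺; x∈p∩q⁻;
         x∈p∧x∉q⇒x∈p─q; x∈p∧x≢y⇒x∈p-y; p─q⊆p; x∈p⇒p-x⊂p; p⊆q⇒∣p∣≤∣q∣)
open import Data.Fin.Subset.Induction using (⊂-wellFounded; Acc; acc)
open import Data.Vec using (_∷_; []; here; there; tabulate) renaming (_++_ to _++ᵛ_)
open import Data.Vec.Properties using (lookup∘tabulate; lookup⇒[]=; []=⇒lookup)
open import Data.List using (List; []; _∷_; _++_; [_]; length; last; map)
import Data.List as List
open import Data.List.Properties using (length-map; length-++; ++-assoc)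
open import Data.List.Relation.Unary.All using (All; []; _∷_)
import Data.List.Relation.Unary.All as All
import Data.List.Relation.Unary.All.Properties as All
open import Data.List.Relation.Unary.AllPairs using (AllPairs; []; _∷_)
import Data.List.Relation.Unary.AllPairs as AllPairs
import Data.List.Relation.Unary.AllPairs.Properties as AllPairs
import Data.List.Relation.Unary.Any as Any
open import Data.List.Relation.Unary.Unique.Propositional using (Unique)
open import Data.List.Membership.Propositional using () renaming (_∈_ to _∈ₗ_)
open import Data.List.Membership.Propositional.Properties using (∈-∃++; ∈-lookup)
open import Data.Maybe using (just)
open import Data.Product using (∃₂; ∃-syntax; _×_; _,_; proj₁; proj₂)
import Data.Product as Product
open import Data.Sum using (_⊎_; inj₁; inj₂)
import Data.Sum as Sum
import Data.Empty
open import Function using (_∘_)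
open import Relation.Nullary using (¬_; Dec; yes; no; does; _×-dec_; _⊎-dec_; ¬?)
open import Relation.Nullary.Decidable using (dec-true; decidable-stable; ¬¬-excluded-middle)
open import Relation.Nullary.Negation using (contradiction; ¬¬-map)
open import Relation.Unary using (Decidable)
open import Relation.Binary.PropositionalEquality using (_≡_; _≢_; refl; sym; trans; cong; cong₂; subst; subst₂; module ≡-Reasoning)

-- Subsets and their sizes

∣p∪q∣≤∣p∣+∣q∣ : ∀ {n} (p q : Subset n) → ∣ p ∪ q ∣ ≤ ∣ p ∣ + ∣ q ∣
∣p∪q∣≤∣p∣+∣q∣ []            []            = z≤n
∣p∪q∣≤∣p∣+∣q∣ (inside  ∷ p) (inside  ∷ q) = s≤s (≤-trans (∣p∪q∣≤∣p∣+∣q∣ p q) (+-monoʳ-≤ ∣ p ∣ (n≤1+n ∣ q ∣)))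
∣p∪q∣≤∣p∣+∣q∣ (inside  ∷ p) (outside ∷ q) = s≤s (∣p∪q∣≤∣p∣+∣q∣ p q)
∣p∪q∣≤∣p∣+∣q∣ (outside ∷ p) (inside  ∷ q) = ≤-trans (s≤s (∣p∪q∣≤∣p∣+∣q∣ p q)) (≤-reflexive (sym (+-suc ∣ p ∣ ∣ q ∣)))
∣p∪q∣≤∣p∣+∣q∣ (outside ∷ p) (outside ∷ q) = ∣p∪q∣≤∣p∣+∣q∣ p q

∣p∣≡∣p∩q∣+∣p─q∣ : ∀ {n} (p q : Subset n) → ∣ p ∣ ≡ ∣ p ∩ q ∣ + ∣ p ─ q ∣
∣p∣≡∣p∩q∣+∣p─q∣ []            []            = refl
∣p∣≡∣p∩q∣+∣p─q∣ (inside  ∷ p) (inside  ∷ q) = cong suc (∣p∣≡∣p∩q∣+∣p─q∣ p q)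
∣p∣≡∣p∩q∣+∣p─q∣ (inside  ∷ p) (outside ∷ q) = trans (cong suc (∣p∣≡∣p∩q∣+∣p─q∣ p q)) (sym (+-suc _ _))
∣p∣≡∣p∩q∣+∣p─q∣ (outside ∷ p) (inside  ∷ q) = ∣p∣≡∣p∩q∣+∣p─q∣ p q
∣p∣≡∣p∩q∣+∣p─q∣ (outside ∷ p) (outside ∷ q) = ∣p∣≡∣p∩q∣+∣p─q∣ p q

∣p++q∣≡∣p∣+∣q∣ : ∀ {m n} (p : Subset m) (q : Subset n) → ∣ p ++ᵛ q ∣ ≡ ∣ p ∣ + ∣ q ∣
∣p++q∣≡∣p∣+∣q∣ []            q = refl
∣p++q∣≡∣p∣+∣q∣ (inside  ∷ p) q = cong suc (∣p++q∣≡∣p∣+∣q∣ p q)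
∣p++q∣≡∣p∣+∣q∣ (outside ∷ p) q = ∣p++q∣≡∣p∣+∣q∣ p q

∈-++⁺ˡ : ∀ {m n} {x : Fin m} {p : Subset m} {q : Subset n} → x ∈ p → x ↑ˡ n ∈ p ++ᵛ q
∈-++⁺ˡ here       = here
∈-++⁺ˡ (there x∈p) = there (∈-++⁺ˡ x∈p)

∈-++⁺ʳ : ∀ {m n} {x : Fin n} (p : Subset m) {q : Subset n} → x ∈ q → m ↑ʳ x ∈ p ++ᵛ q
∈-++⁺ʳ []      x∈q = x∈q
∈-++⁺ʳ (_ ∷ p) x∈q = there (∈-++⁺ʳ p x∈q)

x∈p─q⇒x∉q : ∀ {n} {x : Fin n} (p q : Subset n) → x ∈ p ─ q → x ∉ q
x∈p─q⇒x∉q (_ ∷ p) (inside  ∷ q) (there x∈) (there x∈q) = x∈p─q⇒x∉q p q x∈ x∈q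
x∈p─q⇒x∉q (_ ∷ p) (outside ∷ q) (there x∈) (there x∈q) = x∈p─q⇒x∉q p q x∈ x∈q

x∈p-y⇒x≢y : ∀ {n} {x y : Fin n} (p : Subset n) → x ∈ p - y → x ≢ y
x∈p-y⇒x≢y {y = y} p x∈ refl = x∈p─q⇒x∉q p ⁅ y ⁆ x∈ (x∈⁅x⁆ y)

select : ∀ {n} {P : Fin n → Set} → Decidable P → Subset n
select P? = tabulate (does ∘ P?)

module _ {n} {P : Fin n → Set} (P? : Decidable P) where

  ∈select⁺ : ∀ {x} → P x → x ∈ select P?
  ∈select⁺ {x} px = lookup⇒[]= x _ (trans (lookup∘tabulate _ x) (dec-true (P? x) px))

  ∈select⁻ : ∀ {x} → x ∈ select P? → P x
  ∈select⁻ {x} x∈ with P? x | trans (sym (lookup∘tabulate (does ∘ P?) x)) ([]=⇒lookup x∈)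
  ... | yes px | _ = px
  ... | no  _  | ()

image : ∀ {m n} → (Fin m → Fin n) → Subset m → Subset n
image f []            = ⊥
image f (inside  ∷ p) = ⁅ f zero ⁆ ∪ image (f ∘ suc) p
image f (outside ∷ p) = image (f ∘ suc) p

∈image⁺ : ∀ {m n} (f : Fin m → Fin n) p {x} → x ∈ p → f x ∈ image f p
∈image⁺ f (inside  ∷ p) here        = x∈p∪q⁺ (inj₁ (x∈⁅x⁆ (f zero)))
∈image⁺ f (inside  ∷ p) (there x∈p) = x∈p∪q⁺ (inj₂ (∈image⁺ (f ∘ suc) p x∈p))
∈image⁺ f (outside ∷ p) (there x∈p) = ∈image⁺ (f ∘ suc) p x∈p

∣image∣≤∣p∣ : ∀ {m n} (f : Fin m → Fin n) p → ∣ image f p ∣ ≤ ∣ p ∣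
∣image∣≤∣p∣ {n = n} f [] = ≤-reflexive (∣⊥∣≡0 n)
∣image∣≤∣p∣ f (inside  ∷ p) = ≤-trans (∣p∪q∣≤∣p∣+∣q∣ ⁅ f zero ⁆ (image (f ∘ suc) p))
  (+-mono-≤ (≤-reflexive (∣⁅x⁆∣≡1 (f zero))) (∣image∣≤∣p∣ (f ∘ suc) p))
∣image∣≤∣p∣ f (outside ∷ p) = ∣image∣≤∣p∣ (f ∘ suc) p

pairwise-disjoint-bound : ∀ {n m} (p : Subset n) (As : List (Subset n)) →
  AllPairs (λ A B → Empty (A ∩ B)) As → All (λ A → m ≤ ∣ p ∩ A ∣) As → length As * m ≤ ∣ p ∣
pairwise-disjoint-bound p [] _ _ = z≤n
pairwise-disjoint-bound {m = m} p (A ∷ As) (A#As ∷ disjoint) (m≤∣p∩A∣ ∷ m≤) = begin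
  m + length As * m     ≤⟨ +-mono-≤ m≤∣p∩A∣ (pairwise-disjoint-bound (p ─ A) As disjoint (All.zipWith shrink (A#As , m≤))) ⟩
  ∣ p ∩ A ∣ + ∣ p ─ A ∣ ≡⟨ sym (∣p∣≡∣p∩q∣+∣p─q∣ p A) ⟩
  ∣ p ∣                 ∎
  where
  open ≤-Reasoning
  shrink : ∀ {B} → Empty (A ∩ B) × m ≤ ∣ p ∩ B ∣ → m ≤ ∣ (p ─ A) ∩ B ∣
  shrink {B} (A#B , m≤∣p∩B∣) = ≤-trans m≤∣p∩B∣ (p⊆q⇒∣p∣≤∣q∣ move)
    where
    move : ∀ {x} → x ∈ p ∩ B → x ∈ (p ─ A) ∩ B
    move x∈ with x∈p∩q⁻ p B x∈
    ... | x∈p , x∈B = x∈p∩q⁺ (x∈p∧x∉q⇒x∈p─q x∈p (λ x∈A → A#B (_ , x∈p∩q⁺ (x∈A , x∈B))) , x∈B)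

-- Lists and paths

unique-lookup-distinct : ∀ {A : Set} {xs : List A} → Unique xs → ∀ {i j} → i <ᶠ j → List.lookup xs i ≢ List.lookup xs j
unique-lookup-distinct {xs = x ∷ xs} (x∉xs ∷ _) {zero}  {suc j} _         = All.lookup x∉xs (∈-lookup j)
unique-lookup-distinct {xs = x ∷ xs} (_ ∷ unique) {suc i} {suc j} (s≤s i<j) = unique-lookup-distinct unique i<j

unique⇒length≤ : ∀ {n} {xs : List (Fin n)} → Unique xs → length xs ≤ n
unique⇒length≤ {n} {xs} unique with length xs ≤? n
... | yes ≤n = ≤n
... | no  ≰n with pigeonhole (≰⇒> ≰n) (List.lookup xs)
...   | i , j , i<j , same = contradiction same (unique-lookup-distinct unique i<j)

allPairs-++⁻ˡ : ∀ {A : Set} {R : A → A → Set} xs {ys} → AllPairs R (xs ++ ys) → AllPairs R xs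
allPairs-++⁻ˡ []       _            = []
allPairs-++⁻ˡ (x ∷ xs) (x~ ∷ pairs) = All.++⁻ˡ xs x~ ∷ allPairs-++⁻ˡ xs pairs

allPairs-mapWith : ∀ {A : Set} {P : A → Set} {R S : A → A → Set} →
  (∀ {x y} → P x → P y → R x y → S x y) → ∀ {xs} → All P xs → AllPairs R xs → AllPairs S xs
allPairs-mapWith f []         []             = []
allPairs-mapWith f (px ∷ pxs) (x~xs ∷ pairs) =
  All.zipWith (λ (py , x~y) → f px py x~y) (pxs , x~xs) ∷ allPairs-mapWith f pxs pairs

last-∷ʳ : ∀ {A : Set} (xs : List A) c → last (xs ++ [ c ]) ≡ just c
last-∷ʳ []           c = refl
last-∷ʳ (x ∷ [])     c = refl
last-∷ʳ (x ∷ y ∷ xs) c = last-∷ʳ (y ∷ xs) c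

chain-++⁻ˡ : ∀ {G} xs {ys} → Chain G (xs ++ ys) → Chain G xs
chain-++⁻ˡ []           _            = nil
chain-++⁻ˡ (x ∷ [])     _            = one
chain-++⁻ˡ (x ∷ y ∷ xs) (cons x~y c) = cons x~y (chain-++⁻ˡ (y ∷ xs) c)

-- Domination and packings

Acyclic : Digraph → Set
Acyclic G = ∀ cs → ¬ Cycle G cs

DecidableArcs : Digraph → Set
DecidableArcs G = ∀ u v → Dec (arc G u v)

¬¬-∀Fin : ∀ {n} {P : Fin n → Set} → (∀ i → ¬ ¬ P i) → ¬ ¬ (∀ i → P i)
¬¬-∀Fin {zero}  _   k = k (λ ())
¬¬-∀Fin {suc n} ¬¬P k = ¬¬P zero λ P0 → ¬¬-∀Fin (¬¬P ∘ suc) λ Psuc → k λ { zero → P0 ; (suc i) → Psuc i }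

¬¬-decidableArcs : ∀ G → ¬ ¬ DecidableArcs G
¬¬-decidableArcs G = ¬¬-∀Fin λ u → ¬¬-∀Fin λ v → ¬¬-excluded-middle

Dominates : (G : Digraph) → Fin (n G) → Fin (n G) → Set
Dominates G u v = u ≡ v ⊎ arc G u v

dominates? : ∀ G → DecidableArcs G → ∀ u v → Dec (Dominates G u v)
dominates? G arc? u v = (u ≟ v) ⊎-dec arc? u v

Dominated : (G : Digraph) → Subset (n G) → Fin (n G) → Set
Dominated G S v = ∃[ u ] (u ∈ S × Dominates G u v)

dominating⁺ : ∀ {G S} → (∀ v → Dominated G S v) → Dominating G S
dominating⁺ dominated v with dominated v
... | u , u∈S , inj₁ refl = inj₁ u∈S
... | u , u∈S , inj₂ u⇒v  = inj₂ (u , u∈S , u⇒v)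

dominating⁻ : ∀ {G S} → Dominating G S → ∀ v → Dominated G S v
dominating⁻ dominating v with dominating v
... | inj₁ v∈S             = v , v∈S , inj₁ refl
... | inj₂ (u , u∈S , u⇒v) = u , u∈S , inj₂ u⇒v

Separated : (G : Digraph) → Subset (n G) → Fin (n G) → Fin (n G) → Set
Separated G W p q = ∀ {g} → g ∈ W → Dominates G g p → Dominates G g q → Data.Empty.⊥

Packing : (G : Digraph) → List (Fin (n G)) → Set
Packing G = AllPairs (Separated G ⊤)

module AcyclicDigraph (G : Digraph) (arc? : DecidableArcs G) (acyclic : Acyclic G) where

  open import Data.List.Membership.DecPropositional (_≟_ {n G}) using () renaming (_∈?_ to _∈ₗ?_)

  adj-sym : ∀ {u v} → Adj G u v → Adj G v u
  adj-sym = Sum.swap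

  adj-irrefl : ∀ {u} → ¬ Adj G u u
  adj-irrefl (inj₁ a) = irrefl G _ a
  adj-irrefl (inj₂ a) = irrefl G _ a

  adj? : ∀ u v → Dec (Adj G u v)
  adj? u v = arc? u v ⊎-dec arc? v u

  IsLeafIn : Subset (n G) → Fin (n G) → Set
  IsLeafIn W ℓ = ∀ {a b} → a ∈ W → b ∈ W → Adj G ℓ a → Adj G ℓ b → a ≡ b

  adjacent-on-path⇒previous : ∀ {e w c} xs → Unique (e ∷ w ∷ xs) → Chain G (e ∷ w ∷ xs) →
                              c ∈ₗ w ∷ xs → Adj G e c → c ≡ w
  adjacent-on-path⇒previous xs _ _ (Any.here c≡w) _ = c≡w
  adjacent-on-path⇒previous {e} {w} {c} xs unique chain (Any.there c∈xs) e~c with ∈-∃++ c∈xs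
  ... | ys , zs , refl = contradiction
        (length≥3 , allPairs-++⁻ˡ cycle (subst Unique split unique) ,
         chain-++⁻ˡ cycle (subst (Chain G) split chain) , c , last-∷ʳ (e ∷ w ∷ ys) c , adj-sym e~c)
        (acyclic cycle)
    where
    cycle : List (Fin (n G))
    cycle = e ∷ w ∷ ys ++ [ c ]
    split : e ∷ w ∷ ys ++ c ∷ zs ≡ cycle ++ zs
    split = cong (λ l → e ∷ w ∷ l) (sym (++-assoc ys [ c ] zs))
    length≥3 : 3 ≤ length cycle
    length≥3 = s≤s (s≤s (subst (1 ≤_) (sym (length-++ ys)) (m≤n+m 1 (length ys))))

  pathEnd-isLeaf : ∀ {W e} rest → Unique (e ∷ rest) → Chain G (e ∷ rest) →
                   (∀ {c} → c ∈ W → Adj G e c → c ∈ₗ rest) → IsLeafIn W e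
  pathEnd-isLeaf []         _      _     onPath a∈W _   e~a _   with () ← onPath a∈W e~a
  pathEnd-isLeaf {W} {e} (w ∷ rest) unique chain onPath a∈W b∈W e~a e~b =
    trans (previous a∈W e~a) (sym (previous b∈W e~b))
    where
    previous : ∀ {c} → c ∈ W → Adj G e c → c ≡ w
    previous c∈W e~c = adjacent-on-path⇒previous rest unique chain (onPath c∈W e~c) e~c

  -- Extend the path e ∷ rest at e through W while possible; a path has at most n G vertices, so k suffices.
  longestPath-leaf : ∀ {W} k e rest → e ∈ W → Unique (e ∷ rest) → Chain G (e ∷ rest) →
                     n G ≤ length rest + k → ∃[ ℓ ] (ℓ ∈ W × IsLeafIn W ℓ)
  longestPath-leaf {W} k e rest e∈W unique chain fuel
    with any? (λ c → (c ∈? W) ×-dec adj? e c ×-dec ¬? (c ∈ₗ? rest))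
  ... | no stuck = e , e∈W , pathEnd-isLeaf rest unique chain onPath
    where
    onPath : ∀ {c} → c ∈ W → Adj G e c → c ∈ₗ rest
    onPath c∈W e~c = decidable-stable (_ ∈ₗ? rest) λ c∉rest → stuck (_ , c∈W , e~c , c∉rest)
  ... | yes (c , c∈W , e~c , c∉rest) = grow k fuel
    where
    unique′ : Unique (c ∷ e ∷ rest)
    unique′ = ((λ { refl → adj-irrefl e~c }) ∷ All.¬Any⇒All¬ rest c∉rest) ∷ unique
    grow : ∀ k → n G ≤ length rest + k → ∃[ ℓ ] (ℓ ∈ W × IsLeafIn W ℓ)
    grow zero    fuel = contradiction (unique⇒length≤ unique′)
                          (<⇒≱ (s≤s (≤-trans fuel (≤-trans (≤-reflexive (+-identityʳ (length rest))) (n≤1+n _)))))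
    grow (suc k) fuel = longestPath-leaf k c (e ∷ rest) c∈W unique′ (cons (adj-sym e~c) chain)
                          (≤-trans fuel (≤-reflexive (+-suc (length rest) k)))

  leaf : ∀ {W} → Nonempty W → ∃[ ℓ ] (ℓ ∈ W × IsLeafIn W ℓ)
  leaf (u , u∈W) = longestPath-leaf (n G) u [] u∈W ([] ∷ []) one ≤-refl

  N⁺[_] : Fin (n G) → Subset (n G)
  N⁺[ d ] = select (dominates? G arc? d)

  AbsorbsDominatorsOf : Subset (n G) → Fin (n G) → Fin (n G) → Set
  AbsorbsDominatorsOf W ℓ d =
    ∀ {g q} → g ∈ W → q ∈ W → q ≢ ℓ → Dominates G g ℓ → Dominates G g q → Dominates G d q

  -- d is a parent of ℓ in W if there is one, ℓ itself otherwise.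
  leaf-dominator : ∀ {W ℓ} → IsLeafIn W ℓ → ∃[ d ] (Dominates G d ℓ × AbsorbsDominatorsOf W ℓ d)
  leaf-dominator {W} {ℓ} isLeaf with any? (λ p → (p ∈? W) ×-dec arc? p ℓ)
  ... | yes (p , p∈W , p⇒ℓ) = p , inj₂ p⇒ℓ , viaParent
    where
    viaParent : AbsorbsDominatorsOf W ℓ p
    viaParent _   _   q≢ℓ (inj₁ refl) (inj₁ refl) = contradiction refl q≢ℓ
    viaParent _   q∈W _   (inj₁ refl) (inj₂ ℓ⇒q)  = inj₁ (isLeaf p∈W q∈W (inj₂ p⇒ℓ) (inj₁ ℓ⇒q))
    viaParent g∈W _   _   (inj₂ g⇒ℓ)  g⇝q         =
      subst (λ x → Dominates G x _) (isLeaf g∈W p∈W (inj₂ g⇒ℓ) (inj₂ p⇒ℓ)) g⇝q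
  ... | no orphan = ℓ , inj₁ refl , viaSelf
    where
    viaSelf : AbsorbsDominatorsOf W ℓ ℓ
    viaSelf _   _ _ (inj₁ refl) g⇝q = g⇝q
    viaSelf g∈W _ _ (inj₂ g⇒ℓ)  _   = contradiction (_ , g∈W , g⇒ℓ) orphan

  separated-without-leaf : ∀ {W ℓ p q} → IsLeafIn W ℓ → p ∈ W - ℓ → q ∈ W - ℓ →
                           Separated G (W - ℓ) p q → Separated G W p q
  separated-without-leaf {W} {ℓ} {p} {q} isLeaf p∈ q∈ separated {g} g∈W g⇝p g⇝q with g ≟ ℓ
  ... | no  g≢ℓ = separated (x∈p∧x≢y⇒x∈p-y g∈W g≢ℓ) g⇝p g⇝q
  ... | yes refl = separated p∈ (inj₁ refl)
                     (inj₁ (isLeaf (p─q⊆p W _ p∈) (p─q⊆p W _ q∈) (inj₁ (arcFromLeaf p∈ g⇝p)) (inj₁ (arcFromLeaf q∈ g⇝q))))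
    where
    arcFromLeaf : ∀ {x} → x ∈ W - ℓ → Dominates G ℓ x → arc G ℓ x
    arcFromLeaf x∈ (inj₁ refl) = contradiction refl (x∈p-y⇒x≢y W x∈)
    arcFromLeaf x∈ (inj₂ ℓ⇒x)  = ℓ⇒x

  -- The vertices of F are already dominated: they need not be dominated again and are not packed.
  record DominationPacking (W F : Subset (n G)) : Set where
    field
      dominators             : Subset (n G)
      packing                : List (Fin (n G))
      dominated              : ∀ {v} → v ∈ W → v ∉ F → Dominated G dominators v
      packing-⊆              : All (λ p → p ∈ W × p ∉ F) packing
      separated              : AllPairs (Separated G W) packing
      ∣dominators∣≤∣packing∣ : ∣ dominators ∣ ≤ length packing

  skip-leaf : ∀ {W F ℓ} → ℓ ∈ F → IsLeafIn W ℓ → DominationPacking (W - ℓ) F → DominationPacking W F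
  skip-leaf {W} {F} {ℓ} ℓ∈F isLeaf result = record
    { dominators             = dominators
    ; packing                = packing
    ; dominated              = λ v∈W v∉F → dominated (x∈p∧x≢y⇒x∈p-y v∈W λ { refl → v∉F ℓ∈F }) v∉F
    ; packing-⊆              = All.map (Product.map₁ (p─q⊆p W _)) packing-⊆
    ; separated              = allPairs-mapWith (λ p∈ q∈ → separated-without-leaf isLeaf (proj₁ p∈) (proj₁ q∈))
                                 packing-⊆ separated
    ; ∣dominators∣≤∣packing∣ = ∣dominators∣≤∣packing∣
    }
    where open DominationPacking result

  take-leaf : ∀ {W F ℓ d} → ℓ ∈ W → ℓ ∉ F → IsLeafIn W ℓ → Dominates G d ℓ → AbsorbsDominatorsOf W ℓ d →
    DominationPacking (W - ℓ) (F ∪ N⁺[ d ]) → DominationPacking W F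
  take-leaf {W} {F} {ℓ} {d} ℓ∈W ℓ∉F isLeaf d⇝ℓ viaD result = record
    { dominators             = dominators ∪ ⁅ d ⁆
    ; packing                = ℓ ∷ packing
    ; dominated              = dominated′
    ; packing-⊆              = (ℓ∈W , ℓ∉F) ∷ All.map (Product.map (p─q⊆p W _) (λ p∉ p∈F → p∉ (x∈p∪q⁺ (inj₁ p∈F))))
                                                     packing-⊆
    ; separated              = All.map separatedFromLeaf packing-⊆ ∷
                               allPairs-mapWith (λ p∈ q∈ → separated-without-leaf isLeaf (proj₁ p∈) (proj₁ q∈))
                                 packing-⊆ separated
    ; ∣dominators∣≤∣packing∣ = ≤-trans (∣p∪q∣≤∣p∣+∣q∣ dominators ⁅ d ⁆)
        (≤-trans (+-mono-≤ ∣dominators∣≤∣packing∣ (≤-reflexive (∣⁅x⁆∣≡1 d))) (≤-reflexive (+-comm (length packing) 1)))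
    }
    where
    open DominationPacking result
    dominated′ : ∀ {v} → v ∈ W → v ∉ F → Dominated G (dominators ∪ ⁅ d ⁆) v
    dominated′ {v} v∈W v∉F with v ∈? N⁺[ d ]
    ... | yes v∈N = d , x∈p∪q⁺ (inj₂ (x∈⁅x⁆ d)) , ∈select⁻ (dominates? G arc? d) v∈N
    ... | no  v∉N with dominated (x∈p∧x≢y⇒x∈p-y v∈W λ { refl → v∉N (∈select⁺ (dominates? G arc? d) d⇝ℓ) })
                                 (λ v∈F∪N → Sum.[ v∉F , v∉N ] (x∈p∪q⁻ F _ v∈F∪N))
    ...   | u , u∈ , u⇝v = u , x∈p∪q⁺ (inj₁ u∈) , u⇝v
    separatedFromLeaf : ∀ {q} → q ∈ W - ℓ × q ∉ F ∪ N⁺[ d ] → Separated G W ℓ q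
    separatedFromLeaf (q∈ , q∉) g∈W g⇝ℓ g⇝q =
      q∉ (x∈p∪q⁺ (inj₂ (∈select⁺ (dominates? G arc? d)
        (viaD g∈W (p─q⊆p W _ q∈) (x∈p-y⇒x≢y W q∈) g⇝ℓ g⇝q))))

  dominationPacking : ∀ W → Acc _⊂_ W → ∀ F → DominationPacking W F
  dominationPacking W (acc smaller) F with nonempty? W
  ... | no empty = record
    { dominators             = ⊥
    ; packing                = []
    ; dominated              = λ v∈W _ → contradiction (_ , v∈W) empty
    ; packing-⊆              = []
    ; separated              = []
    ; ∣dominators∣≤∣packing∣ = ≤-reflexive (∣⊥∣≡0 (n G))
    }
  ... | yes nonempty with leaf nonempty
  ...   | ℓ , ℓ∈W , isLeaf with ℓ ∈? F | leaf-dominator isLeaf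
  ...     | yes ℓ∈F | _ = skip-leaf ℓ∈F isLeaf (dominationPacking (W - ℓ) (smaller (x∈p⇒p-x⊂p ℓ∈W)) F)
  ...     | no  ℓ∉F | d , d⇝ℓ , viaD = take-leaf ℓ∈W ℓ∉F isLeaf d⇝ℓ viaD
                                          (dominationPacking (W - ℓ) (smaller (x∈p⇒p-x⊂p ℓ∈W)) (F ∪ N⁺[ d ]))

-- Cartesian products

ProductArc : (G H : Digraph) → Fin (n G) × Fin (n H) → Fin (n G) × Fin (n H) → Set
ProductArc G H (g , h) (g′ , h′) = (g ≡ g′ × arc H h h′) ⊎ (h ≡ h′ × arc G g g′)

□-dominates⁻ : ∀ G H {u z} → Dominates (G □ H) u z →
  Dominates G (quotient {n G} (n H) u) (quotient {n G} (n H) z) ×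
  Dominates H (remainder {n G} (n H) u) (remainder {n G} (n H) z)
□-dominates⁻ G H (inj₁ refl)                      = inj₁ refl , inj₁ refl
□-dominates⁻ G H (inj₂ (inj₁ (same-row , h⇒h′))) = inj₁ same-row , inj₂ h⇒h′
□-dominates⁻ G H (inj₂ (inj₂ (same-col , g⇒g′))) = inj₂ g⇒g′ , inj₁ same-col

□-dominates⁺ʳ : ∀ G H g {h h′} → Dominates H h h′ → Dominates (G □ H) (combine g h) (combine g h′)
□-dominates⁺ʳ G H g         (inj₁ refl) = inj₁ refl
□-dominates⁺ʳ G H g {h} {h′} (inj₂ h⇒h′) =
  inj₂ (subst₂ (ProductArc G H) (sym (remQuot-combine g h)) (sym (remQuot-combine g h′)) (inj₁ (refl , h⇒h′)))

remQuot-↑ʳ : ∀ {m} k (i : Fin (m * k)) → remQuot {suc m} k (k ↑ʳ i) ≡ (suc (quotient {m} k i) , remainder {m} k i)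
remQuot-↑ʳ {m} k i rewrite splitAt-↑ʳ k (m * k) i = refl

packing-lower-bound : ∀ G H → DecidableArcs G → ∀ {m P D} → (∀ S → Dominating H S → m ≤ ∣ S ∣) →
                      Packing G P → Dominating (G □ H) D → length P * m ≤ ∣ D ∣
packing-lower-bound G H arc? {m} {P} {D} γH≤ packing dominating =
  subst (λ k → k * m ≤ ∣ D ∣) (length-map fibre P)
    (pairwise-disjoint-bound D (map fibre P) (AllPairs.map⁺ (AllPairs.map fibres-disjoint packing))
      (All.map⁺ (All.universal fibre-bound P)))
  where
  row : Fin (n G * n H) → Fin (n G)
  row = quotient {n G} (n H)
  column : Fin (n G * n H) → Fin (n H)
  column = remainder {n G} (n H)
  inFibre? : ∀ q → Decidable (λ z → Dominates G (row z) q)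
  inFibre? q z = dominates? G arc? (row z) q
  fibre : Fin (n G) → Subset (n G * n H)
  fibre q = select (inFibre? q)
  fibres-disjoint : ∀ {p q} → Separated G ⊤ p q → Empty (fibre p ∩ fibre q)
  fibres-disjoint {p} {q} sep (z , z∈) with x∈p∩q⁻ (fibre p) (fibre q) z∈
  ... | z∈p , z∈q = sep ∈⊤ (∈select⁻ (inFibre? p) z∈p) (∈select⁻ (inFibre? q) z∈q)
  fibre-bound : ∀ q → m ≤ ∣ D ∩ fibre q ∣
  fibre-bound q = ≤-trans (γH≤ _ (dominating⁺ {H} projection-dominated)) (∣image∣≤∣p∣ column (D ∩ fibre q))
    where
    projection-dominated : ∀ h → Dominated H (image column (D ∩ fibre q)) h
    projection-dominated h with dominating⁻ {G □ H} dominating (combine q h)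
    ... | u , u∈D , u⇝qh with □-dominates⁻ G H u⇝qh | remQuot-combine {n G} {n H} q h
    ...   | row⇝ , column⇝ | qh-coordinates =
      column u ,
      ∈image⁺ column (D ∩ fibre q) (x∈p∩q⁺ (u∈D , ∈select⁺ (inFibre? q) (subst (Dominates G _) (cong proj₁ qh-coordinates) row⇝))) ,
      subst (Dominates H _) (cong proj₂ qh-coordinates) column⇝

-- Adding an out-leaf

addOutLeaf-arc? : ∀ {T} → DecidableArcs T → ∀ v → DecidableArcs (addOutLeaf T v)
addOutLeaf-arc? arc? v zero    zero    = no λ ()
addOutLeaf-arc? arc? v zero    (suc j) = j ≟ v
addOutLeaf-arc? arc? v (suc i) zero    = no λ ()
addOutLeaf-arc? arc? v (suc i) (suc j) = arc? i j

module _ (T : Digraph) (v : Fin (n T)) where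

  private
    T′ : Digraph
    T′ = addOutLeaf T v

  suc-dominates : ∀ {u w} → Dominates T u w → Dominates T′ (suc u) (suc w)
  suc-dominates = Sum.map₁ (cong suc)

  -- The leaf x = zero is taken into the dominating set and the packing; the
  -- rest of T′ is handled by a domination packing of T that ignores v.
  addOutLeaf-packing : DecidableArcs T → Acyclic T →
    ∃₂ λ S P → Dominating T′ S × Packing T′ P × ∣ S ∣ ≤ length P
  addOutLeaf-packing arc? acyclic =
    inside ∷ dominators , zero ∷ map suc packing , dominating⁺ {T′} dominated′ ,
    All.map⁺ (All.map separatedFromLeaf packing-⊆) ∷
      AllPairs.map⁺ (allPairs-mapWith separated-suc packing-⊆ separated) ,
    s≤s (≤-trans ∣dominators∣≤∣packing∣ (≤-reflexive (sym (length-map suc packing))))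
    where
    open AcyclicDigraph T arc? acyclic
    open DominationPacking (dominationPacking ⊤ (⊂-wellFounded ⊤) ⁅ v ⁆)

    dominated′ : ∀ x → Dominated T′ (inside ∷ dominators) x
    dominated′ zero    = zero , here , inj₁ refl
    dominated′ (suc w) with w ≟ v
    ... | yes refl = zero , here , inj₂ refl
    ... | no  w≢v with dominated ∈⊤ (x≢y⇒x∉⁅y⁆ w≢v)
    ...   | u , u∈ , u⇝w = suc u , there u∈ , suc-dominates u⇝w

    root⇝suc : ∀ {p} → p ∉ ⁅ v ⁆ → ¬ Dominates T′ zero (suc p)
    root⇝suc p∉ (inj₂ refl) = p∉ (x∈⁅x⁆ v)

    separatedFromLeaf : ∀ {p} → p ∈ ⊤ × p ∉ ⁅ v ⁆ → Separated T′ ⊤ zero (suc p)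
    separatedFromLeaf (_ , p∉) {zero}  _ _           g⇝p = root⇝suc p∉ g⇝p
    separatedFromLeaf _        {suc _} _ (inj₂ ()) _

    separated-suc : ∀ {p q} → p ∈ ⊤ × p ∉ ⁅ v ⁆ → q ∈ ⊤ × q ∉ ⁅ v ⁆ →
                    Separated T ⊤ p q → Separated T′ ⊤ (suc p) (suc q)
    separated-suc (_ , p∉) _ _   {zero}  _ g⇝p _   = root⇝suc p∉ g⇝p
    separated-suc _        _ sep {suc g} _ g⇝p g⇝q = sep ∈⊤ (unsuc g⇝p) (unsuc g⇝q)
      where
      unsuc : ∀ {w} → Dominates T′ (suc g) (suc w) → Dominates T g w
      unsuc (inj₁ refl) = inj₁ refl
      unsuc (inj₂ a)    = inj₂ a

  module _ (H : Digraph) where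

    □-dominates-↑ʳ : ∀ {k k′} → Dominates (T □ H) k k′ → Dominates (T′ □ H) (n H ↑ʳ k) (n H ↑ʳ k′)
    □-dominates-↑ʳ         (inj₁ refl) = inj₁ refl
    □-dominates-↑ʳ {k} {k′} (inj₂ k⇒k′) =
      inj₂ (subst₂ (ProductArc T′ H) (sym (remQuot-↑ʳ (n H) k)) (sym (remQuot-↑ʳ (n H) k′))
                   (Sum.map₁ (Product.map₁ (cong suc)) k⇒k′))

    -- The fibre {x} × H comes first in T′ □ H; it is dominated by a copy of B, the rest by E.
    addOutLeaf-□-dominating : ∀ {B E} → Dominating H B → Dominating (T □ H) E → Dominating (T′ □ H) (B ++ᵛ E)
    addOutLeaf-□-dominating {B} {E} domB domE = dominating⁺ {T′ □ H} λ z →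
      subst (Dominated (T′ □ H) (B ++ᵛ E)) (join-splitAt (n H) (n T * n H) z) (bySide (splitAt (n H) z))
      where
      bySide : ∀ s → Dominated (T′ □ H) (B ++ᵛ E) (join (n H) (n T * n H) s)
      bySide (inj₁ j) with dominating⁻ {H} domB j
      ... | u , u∈B , u⇝j = u ↑ˡ (n T * n H) , ∈-++⁺ˡ u∈B , □-dominates⁺ʳ T′ H zero u⇝j
      bySide (inj₂ k) with dominating⁻ {T □ H} domE k
      ... | u , u∈E , u⇝k = n H ↑ʳ u , ∈-++⁺ʳ B u∈E , □-dominates-↑ʳ u⇝k

corollary7p5 : (T H : Digraph) → IsDitree T → (γT γH : ℕ) →
    IsDomNumber T γT → IsDomNumber H γH → IsDomNumber (T □ H) (γT * γH) →
    (v : Fin (n T)) → IsDomNumber (addOutLeaf T v) (γT + 1) →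
    IsDomNumber (addOutLeaf T v □ H) ((γT + 1) * γH)
corollary7p5 T H (_ , _ , acyclic) γT γH _ ((B , domB , ∣B∣≡γH) , γH≤) ((E , domE , ∣E∣≡γTγH) , _) v (_ , γT+1≤) =
  (B ++ᵛ E , addOutLeaf-□-dominating T v H domB domE , size) , lower-bound
  where
  size : ∣ B ++ᵛ E ∣ ≡ (γT + 1) * γH
  size = begin
    ∣ B ++ᵛ E ∣    ≡⟨ ∣p++q∣≡∣p∣+∣q∣ B E ⟩
    ∣ B ∣ + ∣ E ∣  ≡⟨ cong₂ _+_ ∣B∣≡γH ∣E∣≡γTγH ⟩
    (1 + γT) * γH ≡⟨ cong (_* γH) (+-comm 1 γT) ⟩
    (γT + 1) * γH ∎
    where open ≡-Reasoning
  -- Decidability of the arcs of T is needed to build the packing; a ≤ between numbers is stable.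
  lower-bound : ∀ D → Dominating (addOutLeaf T v □ H) D → (γT + 1) * γH ≤ ∣ D ∣
  lower-bound D domD = decidable-stable ((γT + 1) * γH ≤? ∣ D ∣) (¬¬-map viaPacking (¬¬-decidableArcs T))
    where
    viaPacking : DecidableArcs T → (γT + 1) * γH ≤ ∣ D ∣
    viaPacking arc? with addOutLeaf-packing T v arc? acyclic
    ... | S , P , domS , packing , ∣S∣≤∣P∣ = begin
      (γT + 1) * γH ≤⟨ *-monoˡ-≤ γH (≤-trans (γT+1≤ S domS) ∣S∣≤∣P∣) ⟩
      length P * γH ≤⟨ packing-lower-bound (addOutLeaf T v) H (addOutLeaf-arc? arc? v) γH≤ packing domD ⟩
      ∣ D ∣         ∎
      where open ≤-Reasoning
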